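{- Let $B$ be a non-regular $2$-connected graph with $\Delta(B)=t$, whose edges are properly colored with colors $1,\dots,t$. If $C$ is a $t$-alternating cycle of $B$ all of whose vertices have degree $t$ in $B$, then there is a $t$-alternating $(\mathrm{ear},C)$-subgraph $H=P_0\cup\dots\cup P_n$ of $B$ with $P_0=C$ and $n\geq 0$, such that either (i) $H$ contains a vertex $x$ with $d_B(x)<t$, or (ii) there is a $t$-alternating path $P_{n+1}$ in $B$ from a vertex $y$ of $H$ to a vertex $x$ with $d_B(x)<t$, such that $y$ is the only common vertex of $P_{n+1}$ and $H$, and $P_{n+1}$ contains the edge colored $t$ incident with $x$, if such an edge exists.
   Context: Graphs are finite and simple. In a properly edge-colored graph, a path or cycle is $t$-alternating if, of any two consecutive edges on it, one has color $t$; it is $(c,t)$-colored if its edges are alternately colored $c$ and $t$. Let $B$ be properly colored with colors $1,\dots,t$, $t=\Delta(B)$, and let $C$ be a $t$-alternating cycle in $B$. A subgraph $H$ of $B$ is a $t$-alternating $(\mathrm{ear},C)$-subgraph if $H=P_0\cup\dots\cup P_n$ for some $n\geq 0$, where $P_0=C$ and, for each $i=1,\dots,n$, $P_i$ is a $(c_i,t)$-colored path for some color $c_i\leq t-1$ which is an ear of $P_0\cup\dots\cup P_i$, i.e., the endpoints of $P_i$ lie in $P_0\cup\dots\cup P_{i-1}$ and its internal vertices have degree $2$ in $P_0\cup\dots\cup P_i$. A graph is non-regular if not all its vertices have the same degree. -}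

module Defs where

open import Data.Nat using (ℕ; zero; suc; _≤_; _<_; _∸_)
open import Data.Fin using (Fin; _≟_)
open import Data.Bool using (Bool; true; false; _∧_; _∨_; T)
open import Data.Maybe using (Maybe; just; nothing; is-just; fromMaybe)
open import Data.List using (List; []; _∷_; _++_; length; map; filterᵇ; take; head; last; concat; concatMap)
open import Data.List.Relation.Unary.All using (All)
open import Data.List.Relation.Unary.Unique.Propositional using (Unique)
open import Data.List.Membership.Propositional using (_∈_)
open import Data.List.Base using (allFin)
open import Data.Bool.ListAction using (any)
open import Data.Product using (_×_; _,_; Σ; ∃; ∃-syntax)
open import Data.Sum using (_⊎_)
open import Relation.Binary.PropositionalEquality using (_≡_; _≢_)
open import Relation.Nullary.Decidable using (⌊_⌋)

-- Finite simple graphs on vertex set Fin N, together with an edge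
-- colouring: col u v = just c  iff  uv is an edge, of colour c.

record Graph (N : ℕ) : Set where
  field
    col      : Fin N → Fin N → Maybe ℕ
    col-sym  : ∀ u v → col u v ≡ col v u
    loopless : ∀ u → col u u ≡ nothing
open Graph public

module _ {N : ℕ} (B : Graph N) where

  Adj : Fin N → Fin N → Set
  Adj u v = T (is-just (col B u v))

  deg : Fin N → ℕ
  deg u = length (filterᵇ (λ w → is-just (col B u w)) (allFin N))

  ProperlyColored : ℕ → Set
  ProperlyColored t =
    (∀ u v c → col B u v ≡ just c → 1 ≤ c × c ≤ t) ×
    (∀ u v w c → col B u v ≡ just c → col B u w ≡ just c → v ≡ w)

  MaxDeg : ℕ → Set
  MaxDeg t = (∀ u → deg u ≤ t) × (∃[ u ] deg u ≡ t)

  NonRegular : Set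
  NonRegular = ∃[ u ] ∃[ v ] deg u ≢ deg v

pairs : {A : Set} → List A → List (A × A)
pairs (a ∷ b ∷ rest) = (a , b) ∷ pairs (b ∷ rest)
pairs _ = []

dropLast : {A : Set} → List A → List A
dropLast [] = []
dropLast (x ∷ []) = []
dropLast (x ∷ y ∷ ys) = x ∷ dropLast (y ∷ ys)

inner : {A : Set} → List A → List A
inner [] = []
inner (_ ∷ xs) = dropLast xs

cpairs : {A : Set} → List A → List (A × A)
cpairs xs = pairs (xs ++ take 1 xs)

module _ {N : ℕ} (B : Graph N) where

  IsWalk : List (Fin N) → Set
  IsWalk p = All (λ e → Adj B (Data.Product.proj₁ e) (Data.Product.proj₂ e)) (pairs p)

  IsPath : List (Fin N) → Set
  IsPath p = 1 ≤ length p × Unique p × IsWalk p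

  IsCycle : List (Fin N) → Set
  IsCycle c = 3 ≤ length c × Unique c ×
              All (λ e → Adj B (Data.Product.proj₁ e) (Data.Product.proj₂ e)) (cpairs c)

  edgeCol : Fin N × Fin N → ℕ
  edgeCol (u , v) = fromMaybe 0 (col B u v)

  pathCols : List (Fin N) → List ℕ
  pathCols p = map edgeCol (pairs p)

  cycleCols : List (Fin N) → List ℕ
  cycleCols c = map edgeCol (cpairs c)

  ConnectedWithout : Fin N → Set
  ConnectedWithout x = ∀ u v → u ≢ x → v ≢ x →
    ∃[ p ] (IsWalk p × head p ≡ just u × last p ≡ just v × All (λ w → w ≢ x) p)

  TwoConnected : Set
  TwoConnected = 3 ≤ N × (∀ x → ConnectedWithout x)

AltLin : ℕ → List ℕ → Set
AltLin t cs = All (λ e → Data.Product.proj₁ e ≡ t ⊎ Data.Product.proj₂ e ≡ t) (pairs cs)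

AltCyc : ℕ → List ℕ → Set
AltCyc t cs = All (λ e → Data.Product.proj₁ e ≡ t ⊎ Data.Product.proj₂ e ≡ t) (cpairs cs)

CTColored : ℕ → ℕ → List ℕ → Set
CTColored c t cs = All (λ a → a ≡ c ⊎ a ≡ t) cs ×
                   All (λ e → Data.Product.proj₁ e ≢ Data.Product.proj₂ e) (pairs cs)

module _ {N : ℕ} where

  hasEdge : List (Fin N × Fin N) → Fin N → Fin N → Bool
  hasEdge es u w = any (λ e → (⌊ Data.Product.proj₁ e ≟ u ⌋ ∧ ⌊ Data.Product.proj₂ e ≟ w ⌋)
                             ∨ (⌊ Data.Product.proj₁ e ≟ w ⌋ ∧ ⌊ Data.Product.proj₂ e ≟ u ⌋)) es

  degIn : List (Fin N × Fin N) → Fin N → ℕ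
  degIn es u = length (filterᵇ (hasEdge es u) (allFin N))

module _ {N : ℕ} (B : Graph N) (t : ℕ) where

  -- p is a (c,t)-coloured path, for some colour c ≤ t-1, which is an ear of
  -- (vs , es) ∪ p, where (vs , es) are the vertices and edges of
  -- P_0 ∪ … ∪ P_{i-1}
  IsEar : List (Fin N) → List (Fin N × Fin N) → List (Fin N) → Set
  IsEar vs es p =
    IsPath B p × 2 ≤ length p ×
    (∃[ c ] (1 ≤ c × c ≤ t ∸ 1 × CTColored c t (pathCols B p))) ×
    (∀ v → head p ≡ just v → v ∈ vs) ×
    (∀ v → last p ≡ just v → v ∈ vs) ×
    All (λ v → degIn (es ++ pairs p) v ≡ 2) (inner p)

  EarSeq : List (Fin N) → List (Fin N × Fin N) → List (List (Fin N)) → Set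
  EarSeq vs es [] = Data.Unit.⊤
    where import Data.Unit
  EarSeq vs es (p ∷ ps) = IsEar vs es p × EarSeq (vs ++ p) (es ++ pairs p) ps

  HVerts : List (Fin N) → List (List (Fin N)) → List (Fin N)
  HVerts C ps = C ++ concat ps

  HEdges : List (Fin N) → List (List (Fin N)) → List (Fin N × Fin N)
  HEdges C ps = cpairs C ++ concatMap pairs ps

  IsAltEarSubgraph : List (Fin N) → List (List (Fin N)) → Set
  IsAltEarSubgraph C ps = EarSeq C (cpairs C) ps

-- Non-regularity with Δ(B) = t gives a vertex x with d(x) < t. Grow H = C ∪ P₁ ∪ … ∪ Pₙ
-- keeping every vertex of H joined to H by its t-coloured edge; this holds on C because C is
-- t-alternating. While x ∉ H, connectivity of B (a consequence of 2-connectivity) gives an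
-- edge ab with a ∈ H, b ∉ H; its colour c is not t, since a's t-edge stays in H. Follow the
-- (c,t)-coloured path a b … outside H. By properness it never revisits a vertex, so it
-- either returns to H, giving a new ear that enlarges H and preserves the invariant, or
-- stops at a vertex missing the next colour, whose degree is then < t: alternative (ii).
-- H grows strictly, so the process ends.
module Submission where

open import Defs
open import Data.Nat using (ℕ; suc; _≤_; _<_; _∸_; z≤n; s≤s) renaming (_≟_ to _≟ℕ_)
open import Data.Nat.Properties
  using (≤-antisym; ≤-trans; ≤-refl; <⇒≤; ≤∧≢⇒<; m≤n⇒m<n∨m≡n; n<1+n; ≤-pred)
open import Data.Fin using (Fin; _≟_)
open import Data.Fin.Properties using (any?)
open import Data.Maybe using (just; is-just)
open import Data.Maybe.Properties using (just-injective; ≡-dec)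
open import Data.Bool using (Bool; T)
open import Data.Bool.Properties using (T-∧; T-∨)
open import Data.List
  using (List; []; _∷_; _++_; _∷ʳ_; length; map; head; last; take; concat; concatMap; filter; filterᵇ; applyUpTo)
open import Data.List.Base using (allFin)
open import Data.List.Properties
  using (++-assoc; ++-identityʳ; map-++; length-map; length-tabulate; length-applyUpTo; concat-++; concatMap-++)
open import Data.List.Relation.Unary.All as All using (All; []; _∷_)
open import Data.List.Relation.Unary.All.Properties using (++⁺)
open import Data.List.Relation.Unary.Any using (here; there)
open import Data.List.Relation.Unary.Any.Properties using (any⁺; any⁻)
open import Data.List.Relation.Unary.AllPairs using ([]; _∷_)
open import Data.List.Relation.Unary.Unique.Propositional using (Unique)
open import Data.List.Relation.Unary.Unique.Propositional.Properties using (allFin⁺; filter⁺)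
open import Data.List.Membership.Propositional using (_∈_; _∉_; find; lose)
open import Data.List.Membership.Propositional.Properties
  using (∈-++⁺ˡ; ∈-++⁺ʳ; ∈-++⁻; ∈-allFin; ∈-filter⁺; ∈-filter⁻; ∈-map⁻; ∈-applyUpTo⁺)
open import Data.Product using (_×_; _,_; ∃₂; ∃-syntax; proj₁; proj₂)
open import Data.Sum using (_⊎_; inj₁; inj₂; [_,_]′; map₁)
open import Data.Empty using (⊥; ⊥-elim)
open import Data.Unit using (tt)
open import Function using (_∘_; id)
open import Function.Bundles using (Equivalence)
open import Relation.Nullary using (yes; no; ¬?)
open import Relation.Nullary.Decidable using (_×-dec_; toWitness; fromWitness)
open import Relation.Binary.PropositionalEquality
  using (_≡_; _≢_; refl; sym; trans; cong; cong₂; subst; subst₂; module ≡-Reasoning)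

open Equivalence using (to; from)

module _ {A : Set} where

  last-∷ʳ : ∀ (xs : List A) b → last (xs ∷ʳ b) ≡ just b
  last-∷ʳ [] b = refl
  last-∷ʳ (x ∷ []) b = refl
  last-∷ʳ (x ∷ y ∷ ys) b = last-∷ʳ (y ∷ ys) b

  ∃-last-∷ : ∀ (x : A) xs → ∃[ a ] (last (x ∷ xs) ≡ just a)
  ∃-last-∷ x [] = x , refl
  ∃-last-∷ x (y ∷ ys) = ∃-last-∷ y ys

  pairs-∷ʳ : ∀ (xs : List A) {a} b → last xs ≡ just a → pairs (xs ∷ʳ b) ≡ pairs xs ∷ʳ (a , b)
  pairs-∷ʳ (x ∷ []) b refl = refl
  pairs-∷ʳ (x ∷ y ∷ ys) b eq = cong ((x , y) ∷_) (pairs-∷ʳ (y ∷ ys) b eq)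

  ∈-pairs⁻ : ∀ {xs : List A} {a b} → (a , b) ∈ pairs xs → a ∈ xs × b ∈ xs
  ∈-pairs⁻ {x ∷ y ∷ ys} (here refl) = here refl , there (here refl)
  ∈-pairs⁻ {x ∷ y ∷ ys} (there m) = let (p , q) = ∈-pairs⁻ {y ∷ ys} m in there p , there q

  pairs-++⁺ˡ : ∀ {xs : List A} ys {e} → e ∈ pairs xs → e ∈ pairs (xs ++ ys)
  pairs-++⁺ˡ {x ∷ y ∷ xs} ys (here refl) = here refl
  pairs-++⁺ˡ {x ∷ y ∷ xs} ys (there m) = there (pairs-++⁺ˡ {y ∷ xs} ys m)

  pairs-map⁺ : ∀ {B : Set} (f : A → B) {xs : List A} {a b} →
               (a , b) ∈ pairs xs → (f a , f b) ∈ pairs (map f xs)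
  pairs-map⁺ f {x ∷ y ∷ xs} (here refl) = here refl
  pairs-map⁺ f {x ∷ y ∷ xs} (there m) = there (pairs-map⁺ f {y ∷ xs} m)

  dropLast-∷ʳ : ∀ (xs : List A) w → dropLast (xs ∷ʳ w) ≡ xs
  dropLast-∷ʳ [] w = refl
  dropLast-∷ʳ (x ∷ []) w = refl
  dropLast-∷ʳ (x ∷ y ∷ xs) w = cong (x ∷_) (dropLast-∷ʳ (y ∷ xs) w)

  ∈-dropLast⁻ : ∀ {xs : List A} {u} → u ∈ dropLast xs → u ∈ xs
  ∈-dropLast⁻ {x ∷ y ∷ xs} (here refl) = here refl
  ∈-dropLast⁻ {x ∷ y ∷ xs} (there m) = there (∈-dropLast⁻ {y ∷ xs} m)

  ∈-inner⁻ : ∀ {xs : List A} {u} → u ∈ inner xs → u ∈ xs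
  ∈-inner⁻ {x ∷ xs} m = there (∈-dropLast⁻ m)

  ∈-cyclic⁻ : ∀ (xs : List A) {z} → z ∈ xs ++ take 1 xs → z ∈ xs
  ∈-cyclic⁻ xs m with ∈-++⁻ xs m
  ... | inj₁ m' = m'
  ∈-cyclic⁻ (x ∷ xs) m | inj₂ (here refl) = here refl

  ∈-remove : ∀ {x : A} {ys} → x ∈ ys →
             ∃[ ys' ] (length ys ≡ suc (length ys') × (∀ {z} → z ∈ ys → z ≡ x ⊎ z ∈ ys'))
  ∈-remove {ys = y ∷ ys} (here refl) = ys , refl , λ { (here e) → inj₁ e ; (there m) → inj₂ m }
  ∈-remove {ys = y ∷ ys} (there m) with ∈-remove m
  ... | ys' , eq , split =
    y ∷ ys' , cong suc eq , λ { (here e) → inj₂ (here e) ; (there m') → keep (split m') }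
    where
    keep : ∀ {z} → z ≡ _ ⊎ z ∈ ys' → z ≡ _ ⊎ z ∈ y ∷ ys'
    keep (inj₁ e) = inj₁ e
    keep (inj₂ m) = inj₂ (there m)

  Unique-⊆⇒length≤ : ∀ {xs ys : List A} → Unique xs → (∀ {z} → z ∈ xs → z ∈ ys) →
                     length xs ≤ length ys
  Unique-⊆⇒length≤ {[]} u sub = z≤n
  Unique-⊆⇒length≤ {x ∷ xs} (x∉xs ∷ u) sub with ∈-remove (sub (here refl))
  ... | ys' , eq , split rewrite eq = s≤s (Unique-⊆⇒length≤ u sub')
    where
    sub' : ∀ {z} → z ∈ xs → z ∈ ys'
    sub' m with split (sub (there m))
    ... | inj₁ e = ⊥-elim (All.lookup x∉xs m (sym e))
    ... | inj₂ m' = m'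

  Unique-∷ʳ : ∀ {xs : List A} {w} → Unique xs → w ∉ xs → Unique (xs ∷ʳ w)
  Unique-∷ʳ {[]} u w∉ = [] ∷ []
  Unique-∷ʳ {x ∷ xs} (x∉ ∷ u) w∉ =
    ++⁺ x∉ ((λ e → w∉ (here (sym e))) ∷ []) ∷ Unique-∷ʳ u (w∉ ∘ there)

  Unique-map⁺ : ∀ {B : Set} (f : A → B) {xs : List A} → Unique xs →
                (∀ {a b} → a ∈ xs → b ∈ xs → f a ≡ f b → a ≡ b) → Unique (map f xs)
  Unique-map⁺ f {[]} u inj = []
  Unique-map⁺ f {x ∷ xs} (x∉ ∷ u) inj =
    All.tabulate (λ m fx≡ → let (z , z∈ , e) = ∈-map⁻ f m in
                            All.lookup x∉ z∈ (inj (here refl) (there z∈) (trans fx≡ e)))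
    ∷ Unique-map⁺ f u (λ p q → inj (there p) (there q))

  Consecutive : List A → A → A → Set
  Consecutive xs u w = (u , w) ∈ pairs xs ⊎ (w , u) ∈ pairs xs

  inner⇒two-neighbours : ∀ (xs : List A) → Unique xs → ∀ {u} → u ∈ inner xs →
    ∃₂ λ a b → a ≢ b × Consecutive xs u a × Consecutive xs u b ×
               (∀ w → Consecutive xs u w → w ≡ a ⊎ w ≡ b)
  inner⇒two-neighbours (x ∷ y ∷ z ∷ rest) (x∉ ∷ (y∉ ∷ _)) (here refl) =
    x , z , All.lookup x∉ (there (here refl)) , inj₂ (here refl) , inj₁ (there (here refl)) , only
    where
    only : ∀ w → Consecutive (x ∷ y ∷ z ∷ rest) y w → w ≡ x ⊎ w ≡ z
    only w (inj₁ (here e)) = ⊥-elim (All.lookup x∉ (here refl) (sym (cong proj₁ e)))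
    only w (inj₁ (there (here e))) = inj₂ (cong proj₂ e)
    only w (inj₁ (there (there m))) = ⊥-elim (All.lookup y∉ (proj₁ (∈-pairs⁻ m)) refl)
    only w (inj₂ (here e)) = inj₁ (cong proj₁ e)
    only w (inj₂ (there (here e))) = ⊥-elim (All.lookup y∉ (here refl) (cong proj₂ e))
    only w (inj₂ (there (there m))) = ⊥-elim (All.lookup y∉ (proj₂ (∈-pairs⁻ m)) refl)
  inner⇒two-neighbours (x ∷ y ∷ z ∷ rest) (x∉ ∷ u'@(y∉ ∷ _)) {u} (there m)
    with inner⇒two-neighbours (y ∷ z ∷ rest) u' m
  ... | a , b , a≢b , na , nb , only = a , b , a≢b , widen na , widen nb , only'
    where
    widen : ∀ {w} → Consecutive (y ∷ z ∷ rest) u w → Consecutive (x ∷ y ∷ z ∷ rest) u w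
    widen (inj₁ q) = inj₁ (there q)
    widen (inj₂ q) = inj₂ (there q)
    u≢y : u ≢ y
    u≢y refl = All.lookup y∉ (∈-dropLast⁻ {z ∷ rest} m) refl
    only' : ∀ w → Consecutive (x ∷ y ∷ z ∷ rest) u w → w ≡ a ⊎ w ≡ b
    only' w (inj₁ (here e)) = ⊥-elim (All.lookup x∉ (∈-inner⁻ {y ∷ z ∷ rest} m) (sym (cong proj₁ e)))
    only' w (inj₁ (there q)) = only w (inj₁ q)
    only' w (inj₂ (here e)) = ⊥-elim (u≢y (cong proj₂ e))
    only' w (inj₂ (there q)) = only w (inj₂ q)

  inner⇒between : ∀ (xs : List A) {u} → u ∈ inner xs →
                  ∃₂ λ a b → ((a , u) , (u , b)) ∈ pairs (pairs xs)
  inner⇒between (x ∷ y ∷ z ∷ rest) (here refl) = x , z , here refl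
  inner⇒between (x ∷ y ∷ z ∷ rest) (there m) with inner⇒between (y ∷ z ∷ rest) m
  ... | a , b , q = a , b , there q

length-filter-allFin≡2 : ∀ {N} (q : Fin N → Bool) {a b} → a ≢ b →
  T (q a) → T (q b) → (∀ w → T (q w) → w ≡ a ⊎ w ≡ b) → length (filterᵇ q (allFin N)) ≡ 2
length-filter-allFin≡2 {N} q {a} {b} a≢b qa qb only = ≤-antisym
  (Unique-⊆⇒length≤ (filter⁺ _ (allFin⁺ N))
    (λ m → listed (only _ (proj₂ (∈-filter⁻ _ {xs = allFin N} m)))))
  (Unique-⊆⇒length≤ ((a≢b ∷ []) ∷ [] ∷ []) λ { (here refl) → ∈-filter⁺ _ (∈-allFin a) qa
                                             ; (there (here refl)) → ∈-filter⁺ _ (∈-allFin b) qb })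
  where
  listed : ∀ {w} → w ≡ a ⊎ w ≡ b → w ∈ a ∷ b ∷ []
  listed (inj₁ e) = here e
  listed (inj₂ e) = there (here e)

module _ {N : ℕ} where
  open import Data.List.Membership.DecPropositional (_≟_ {N}) using (_∈?_)

  hasEdge⁻ : ∀ (es : List (Fin N × Fin N)) u w → T (hasEdge es u w) → (u , w) ∈ es ⊎ (w , u) ∈ es
  hasEdge⁻ es u w h with find (any⁻ _ es h)
  ... | (a , b) , e∈ , match with to T-∨ match
  ...   | inj₁ fwd = let (a≡u , b≡w) = to T-∧ fwd in
          inj₁ (subst (_∈ es) (cong₂ _,_ (toWitness {a? = a ≟ u} a≡u) (toWitness {a? = b ≟ w} b≡w)) e∈)
  ...   | inj₂ bwd = let (a≡w , b≡u) = to T-∧ bwd in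
          inj₂ (subst (_∈ es) (cong₂ _,_ (toWitness {a? = a ≟ w} a≡w) (toWitness {a? = b ≟ u} b≡u)) e∈)

  hasEdge⁺ : ∀ (es : List (Fin N × Fin N)) u w → (u , w) ∈ es ⊎ (w , u) ∈ es → T (hasEdge es u w)
  hasEdge⁺ es u w (inj₁ e∈) = any⁺ _ (lose e∈ (from T-∨ (inj₁ (from T-∧
    (fromWitness {a? = u ≟ u} refl , fromWitness {a? = w ≟ w} refl)))))
  hasEdge⁺ es u w (inj₂ e∈) = any⁺ _ (lose e∈ (from T-∨ (inj₂ (from T-∧
    (fromWitness {a? = w ≟ w} refl , fromWitness {a? = u ≟ u} refl)))))

  degIn-inner≡2 : ∀ (E : List (Fin N × Fin N)) (p : List (Fin N)) → Unique p →
    (∀ {u a b} → u ∈ inner p → (a , b) ∈ E → u ≢ a × u ≢ b) →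
    All (λ u → degIn (E ++ pairs p) u ≡ 2) (inner p)
  degIn-inner≡2 E p up avoids = All.tabulate λ {u} m → degree m (inner⇒two-neighbours p up m)
    where
    degree : ∀ {u} → u ∈ inner p →
      ∃₂ (λ a b → a ≢ b × Consecutive p u a × Consecutive p u b ×
                  (∀ w → Consecutive p u w → w ≡ a ⊎ w ≡ b)) →
      degIn (E ++ pairs p) u ≡ 2
    degree {u} m (a , b , a≢b , na , nb , only) =
      length-filter-allFin≡2 (hasEdge (E ++ pairs p) u) a≢b (edge na) (edge nb) only'
      where
      edge : ∀ {w} → Consecutive p u w → T (hasEdge (E ++ pairs p) u w)
      edge (inj₁ q) = hasEdge⁺ (E ++ pairs p) u _ (inj₁ (∈-++⁺ʳ E q))
      edge (inj₂ q) = hasEdge⁺ (E ++ pairs p) u _ (inj₂ (∈-++⁺ʳ E q))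
      only' : ∀ w → T (hasEdge (E ++ pairs p) u w) → w ≡ a ⊎ w ≡ b
      only' w h with hasEdge⁻ (E ++ pairs p) u w h
      ... | inj₁ m' with ∈-++⁻ E m'
      ...   | inj₁ mE = ⊥-elim (proj₁ (avoids m mE) refl)
      ...   | inj₂ mp = only w (inj₁ mp)
      only' w h | inj₂ m' with ∈-++⁻ E m'
      ...   | inj₁ mE = ⊥-elim (proj₂ (avoids m mE) refl)
      ...   | inj₂ mp = only w (inj₂ mp)

  outside : List (Fin N) → List (Fin N)
  outside V = filter (λ u → ¬? (u ∈? V)) (allFin N)

  outside-shrinks : ∀ {V V' z} → (∀ {u} → u ∈ V → u ∈ V') → z ∈ V' → z ∉ V →
                    length (outside V') < length (outside V)
  outside-shrinks {V} {V'} {z} V⊆V' z∈V' z∉V =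
    Unique-⊆⇒length≤ {xs = z ∷ outside V'} (z-fresh ∷ filter⁺ _ (allFin⁺ N)) sub
    where
    z-fresh : All (z ≢_) (outside V')
    z-fresh = All.tabulate λ m e → proj₂ (∈-filter⁻ _ {xs = allFin N} m) (subst (_∈ V') e z∈V')
    sub : ∀ {u} → u ∈ z ∷ outside V' → u ∈ outside V
    sub (here refl) = ∈-filter⁺ _ (∈-allFin z) z∉V
    sub (there m) = let (u∈ , u∉V') = ∈-filter⁻ _ {xs = allFin N} m in ∈-filter⁺ _ u∈ (u∉V' ∘ V⊆V')

  third-vertex : 3 ≤ N → (a b : Fin N) → ∃[ z ] (z ≢ a × z ≢ b)
  third-vertex 3≤N a b with any? (λ z → ¬? (z ≟ a) ×-dec ¬? (z ≟ b))
  ... | yes (z , z≢a , z≢b) = z , z≢a , z≢b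
  ... | no none = ⊥-elim (N≰2 (subst (_≤ 2) (length-tabulate id) (Unique-⊆⇒length≤ (allFin⁺ N) sub)))
    where
    sub : ∀ {z} → z ∈ allFin N → z ∈ a ∷ b ∷ []
    sub {z} _ with z ≟ a | z ≟ b
    ... | yes e | _ = here e
    ... | no _ | yes e = there (here e)
    ... | no z≢a | no z≢b = ⊥-elim (none (z , z≢a , z≢b))
    N≰2 : N ≤ 2 → ⊥
    N≰2 N≤2 with ≤-trans 3≤N N≤2
    ... | s≤s (s≤s ())

module _ {N : ℕ} (B : Graph N) where
  open import Data.List.Membership.DecPropositional (_≟_ {N}) using (_∈?_)

  Adj⇒col≡just : ∀ {u w} → Adj B u w → col B u w ≡ just (edgeCol B (u , w))
  Adj⇒col≡just {u} {w} adj with col B u w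
  ... | just k = refl

  adj-col : ∀ {u w k} → col B u w ≡ just k → Adj B u w
  adj-col e rewrite e = tt

  edgeCol-col : ∀ {u w k} → col B u w ≡ just k → edgeCol B (u , w) ≡ k
  edgeCol-col e rewrite e = refl

  TwoConnected⇒connected : TwoConnected B →
                           ∀ u v → ∃[ p ] (IsWalk B p × head p ≡ just u × last p ≡ just v)
  TwoConnected⇒connected (3≤N , connected-without) u v with third-vertex 3≤N u v
  ... | z , z≢u , z≢v with connected-without z u v (z≢u ∘ sym) (z≢v ∘ sym)
  ...   | p , walk , hd , lst , _ = p , walk , hd , lst

  walk-leaves : ∀ (V W : List (Fin N)) {h x} → IsWalk B W → head W ≡ just h → h ∈ V →
                last W ≡ just x → x ∉ V → ∃₂ λ a b → a ∈ V × b ∉ V × Adj B a b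
  walk-leaves V (h ∷ []) _ refl h∈V refl x∉V = ⊥-elim (x∉V h∈V)
  walk-leaves V (h ∷ h' ∷ W) (adj ∷ walk) refl h∈V lst x∉V with h' ∈? V
  ... | yes h'∈V = walk-leaves V (h' ∷ W) walk refl h'∈V lst x∉V
  ... | no h'∉V = h , h' , h∈V , h'∉V , adj

  nonRegular⇒low-degree : ∀ {t} → NonRegular B → MaxDeg B t → ∃[ x ] (deg B x < t)
  nonRegular⇒low-degree (u , v , du≢dv) (deg≤t , _)
    with m≤n⇒m<n∨m≡n (deg≤t u) | m≤n⇒m<n∨m≡n (deg≤t v)
  ... | inj₁ du<t | _ = u , du<t
  ... | inj₂ _ | inj₁ dv<t = v , dv<t
  ... | inj₂ du≡t | inj₂ dv≡t = ⊥-elim (du≢dv (trans du≡t (sym dv≡t)))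

  -- The colours at v are distinct elements of {1,…,t} other than a.
  missing-colour⇒deg< : ∀ {t} → ProperlyColored B t → ∀ v {a} → 1 ≤ a → a ≤ t →
                        (∀ w → col B v w ≢ just a) → deg B v < t
  missing-colour⇒deg< {t} (colour-range , proper) v {a} 1≤a a≤t missing =
    subst₂ (λ m n → suc m ≤ n) (length-map colour nbrs) (length-applyUpTo suc t)
      (Unique-⊆⇒length≤ (a-fresh ∷ Unique-map⁺ colour (filter⁺ _ (allFin⁺ N)) colour-injective) sub)
    where
    nbrs : List (Fin N)
    nbrs = filterᵇ (λ w → is-just (col B v w)) (allFin N)
    colour : Fin N → ℕ
    colour w = edgeCol B (v , w)
    nbr-col : ∀ {w} → w ∈ nbrs → col B v w ≡ just (colour w)
    nbr-col m = Adj⇒col≡just (proj₂ (∈-filter⁻ _ {xs = allFin N} m))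
    colour-injective : ∀ {w w'} → w ∈ nbrs → w' ∈ nbrs → colour w ≡ colour w' → w ≡ w'
    colour-injective m m' e = proper v _ _ _ (nbr-col m) (trans (nbr-col m') (cong just (sym e)))
    a-fresh : All (a ≢_) (map colour nbrs)
    a-fresh = All.tabulate λ m a≡ → let (w , w∈ , e) = ∈-map⁻ colour m in
      missing w (trans (nbr-col w∈) (cong just (sym (trans a≡ e))))
    in-range : ∀ {k} → 1 ≤ k → k ≤ t → k ∈ applyUpTo suc t
    in-range {suc i} _ i<t = ∈-applyUpTo⁺ suc i<t
    sub : ∀ {k} → k ∈ a ∷ map colour nbrs → k ∈ applyUpTo suc t
    sub (here refl) = in-range 1≤a a≤t
    sub (there m) with ∈-map⁻ colour m
    ... | w , w∈ , refl = let (lo , hi) = colour-range v w _ (nbr-col w∈) in in-range lo hi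

CTColored⇒AltLin : ∀ {c t} (cs : List ℕ) → CTColored c t cs → AltLin t cs
CTColored⇒AltLin [] _ = []
CTColored⇒AltLin (a ∷ []) _ = []
CTColored⇒AltLin {c} {t} (a ∷ b ∷ cs) (ca ∷ cb ∷ ccs , a≢b ∷ alt) =
  one-is-t ca cb a≢b ∷ CTColored⇒AltLin (b ∷ cs) (cb ∷ ccs , alt)
  where
  one-is-t : ∀ {a b} → a ≡ c ⊎ a ≡ t → b ≡ c ⊎ b ≡ t → a ≢ b → a ≡ t ⊎ b ≡ t
  one-is-t (inj₁ refl) (inj₁ refl) a≢b = ⊥-elim (a≢b refl)
  one-is-t (inj₂ a≡t) _ _ = inj₁ a≡t
  one-is-t (inj₁ _) (inj₂ b≡t) _ = inj₂ b≡t

module _ {N : ℕ} (B : Graph N) (t : ℕ) where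

  -- Each vertex of C sits between two consecutive edges of the closed walk,
  -- and one of these has colour t.
  altCycle⇒t-edge : ∀ C → IsCycle B C → AltCyc t (cycleCols B C) →
                    ∀ {u} → u ∈ C → ∃[ w ] (w ∈ C × col B u w ≡ just t)
  altCycle⇒t-edge [] (() , _) _ _
  altCycle⇒t-edge (x₀ ∷ []) (s≤s () , _) _ _
  altCycle⇒t-edge C@(x₀ ∷ x₁ ∷ xs) (_ , _ , adjacent) alt {u} u∈C = t-edge (between u∈C)
    where
    es : List (Fin N × Fin N)
    es = cpairs C
    Between : Fin N → Set
    Between u = ∃₂ λ a b → ((a , u) , (u , b)) ∈ pairs (es ∷ʳ (x₀ , x₁))
    between : ∀ {u} → u ∈ C → Between u
    between (here refl) with ∃-last-∷ x₀ (x₁ ∷ xs)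
    ... | z , last≡z = z , x₁ ,
      subst (λ l → ((z , x₀) , (x₀ , x₁)) ∈ pairs (l ∷ʳ (x₀ , x₁))) (sym (pairs-∷ʳ C x₀ last≡z))
        (subst (((z , x₀) , (x₀ , x₁)) ∈_)
          (sym (pairs-∷ʳ (pairs C ∷ʳ (z , x₀)) (x₀ , x₁) (last-∷ʳ (pairs C) (z , x₀))))
          (∈-++⁺ʳ _ (here refl)))
    between {u} (there m)
      with inner⇒between (C ∷ʳ x₀) (subst (u ∈_) (sym (dropLast-∷ʳ (x₁ ∷ xs) x₀)) m)
    ... | a , b , q = a , b , pairs-++⁺ˡ _ q
    edge-of : ∀ {e} → e ∈ es ∷ʳ (x₀ , x₁) → e ∈ es
    edge-of = ∈-cyclic⁻ es
    t-edge : Between u → ∃[ w ] (w ∈ C × col B u w ≡ just t)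
    t-edge (a , b , q)
      with All.lookup alt (subst (λ l → (edgeCol B (a , u) , edgeCol B (u , b)) ∈ pairs l)
                                 (map-++ (edgeCol B) es _) (pairs-map⁺ (edgeCol B) q))
    ... | inj₁ au≡t = let au∈es = edge-of (proj₁ (∈-pairs⁻ q)) in
      a , ∈-cyclic⁻ C (proj₁ (∈-pairs⁻ au∈es)) ,
      trans (col-sym B u a) (trans (Adj⇒col≡just B (All.lookup adjacent au∈es)) (cong just au≡t))
    ... | inj₂ ub≡t = let ub∈es = edge-of (proj₂ (∈-pairs⁻ q)) in
      b , ∈-cyclic⁻ C (proj₂ (∈-pairs⁻ ub∈es)) ,
      trans (Adj⇒col≡just B (All.lookup adjacent ub∈es)) (cong just ub≡t)

  TClosed : List (Fin N) → Set
  TClosed V = ∀ {u} → u ∈ V → ∃[ w ] (w ∈ V × col B u w ≡ just t)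

  EscapePath : List (Fin N) → Set
  EscapePath V = ∃[ P ] ∃[ y ] ∃[ x ]
    (IsPath B P × AltLin t (pathCols B P) ×
     head P ≡ just y × last P ≡ just x ×
     y ∈ V × deg B x < t ×
     All (λ v → v ∈ V → v ≡ y) P ×
     (∀ w → col B x w ≡ just t → (x , w) ∈ pairs P ⊎ (w , x) ∈ pairs P))

  record NewEar (V : List (Fin N)) (E : List (Fin N × Fin N)) : Set where
    field
      ear : List (Fin N)
      isEar : IsEar B t V E ear
      new : Fin N
      new∈ear : new ∈ ear
      new∉V : new ∉ V
      tClosed : TClosed (V ++ ear)

EdgesWithin : ∀ {N} → List (Fin N) → List (Fin N × Fin N) → Set
EdgesWithin V E = ∀ {a b} → (a , b) ∈ E → a ∈ V × b ∈ V

module GrowingPath {N : ℕ} (B : Graph N) {t : ℕ} (PC : ProperlyColored B t)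
                   {V : List (Fin N)} {E : List (Fin N × Fin N)}
                   (closed : TClosed B t V) (within : EdgesWithin V E)
                   {y b : Fin N} {c : ℕ} (y∈V : y ∈ V) (b∉V : b ∉ V) (yb : col B y b ≡ just c) where
  open import Data.List.Membership.DecPropositional (_≟_ {N}) using (_∈?_)

  unique-colour : ∀ {u v w k} → col B u v ≡ just k → col B u w ≡ just k → v ≡ w
  unique-colour {u} {v} {w} {k} = proj₂ PC u v w k

  y-t-edge : ∀ w → col B y w ≡ just t → w ∈ V
  y-t-edge w yw with closed y∈V
  ... | w' , w'∈V , yw' = subst (_∈ V) (unique-colour yw' yw) w'∈V

  c≢t : c ≢ t
  c≢t c≡t = b∉V (y-t-edge b (trans yb (cong just c≡t)))

  1≤c : 1 ≤ c
  1≤c = proj₁ (proj₁ PC y b c yb)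

  c<t : c < t
  c<t = ≤∧≢⇒< (proj₂ (proj₁ PC y b c yb)) c≢t

  CT : ℕ → Set
  CT d = d ≡ c ⊎ d ≡ t

  CT-range : ∀ {d} → CT d → 1 ≤ d × d ≤ t
  CT-range (inj₁ refl) = 1≤c , <⇒≤ c<t
  CT-range (inj₂ refl) = ≤-trans 1≤c (<⇒≤ c<t) , ≤-refl

  record OtherColour (ℓ : ℕ) : Set where
    field
      ℓ' : ℕ
      ℓ'-CT : CT ℓ'
      ℓ≢ℓ' : ℓ ≢ ℓ'
      one-is-t : ℓ ≡ t ⊎ ℓ' ≡ t
      CT⇒ℓ⊎ℓ' : ∀ d → CT d → d ≡ ℓ ⊎ d ≡ ℓ'

  other-colour : ∀ {ℓ} → CT ℓ → OtherColour ℓ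
  other-colour (inj₁ refl) = record
    { ℓ' = t ; ℓ'-CT = inj₂ refl ; ℓ≢ℓ' = c≢t ; one-is-t = inj₂ refl
    ; CT⇒ℓ⊎ℓ' = λ { d (inj₁ e) → inj₁ e ; d (inj₂ e) → inj₂ e } }
  other-colour (inj₂ refl) = record
    { ℓ' = c ; ℓ'-CT = inj₁ refl ; ℓ≢ℓ' = c≢t ∘ sym ; one-is-t = inj₁ refl
    ; CT⇒ℓ⊎ℓ' = λ { d (inj₁ e) → inj₂ e ; d (inj₂ e) → inj₁ e } }

  ClosedAt : List (Fin N) → Fin N → Set
  ClosedAt P u = ∀ w d → CT d → col B u w ≡ just d → w ∈ P ⊎ w ∈ V

  -- closedAt and endEdges keep the path simple: an edge of the other colour ℓ' at end
  -- cannot lead back into the path.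
  record AltPath : Set where
    field
      tail : List (Fin N)
      end : Fin N
      ℓ : ℕ
      pen : Fin N
      last≡end : last (y ∷ tail) ≡ just end
      end∈tail : end ∈ tail
      unique : Unique (y ∷ tail)
      walk : IsWalk B (y ∷ tail)
      ctColoured : CTColored c t (pathCols B (y ∷ tail))
      lastColour : last (pathCols B (y ∷ tail)) ≡ just ℓ
      ℓ-CT : CT ℓ
      lastEdge : (pen , end) ∈ pairs (y ∷ tail)
      lastEdge-col : col B pen end ≡ just ℓ
      tail∉V : ∀ {u} → u ∈ tail → u ∉ V
      closedAt : ∀ {u} → u ∈ y ∷ tail → u ≢ end → ClosedAt (y ∷ tail) u
      endEdges : ∀ {u} → u ∈ y ∷ tail → ∀ d → CT d → col B end u ≡ just d → d ≡ ℓ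
      tPartner : ∀ {u} → u ∈ tail → u ≢ end → ∃[ w ] (w ∈ y ∷ tail × col B u w ≡ just t)

  start : AltPath
  start = record
    { tail = b ∷ [] ; end = b ; ℓ = c ; pen = y ; last≡end = refl ; end∈tail = here refl
    ; unique = (y≢b ∷ []) ∷ [] ∷ [] ; walk = adj-col B yb ∷ []
    ; ctColoured = inj₁ (edgeCol-col B yb) ∷ [] , [] ; lastColour = cong just (edgeCol-col B yb)
    ; ℓ-CT = inj₁ refl ; lastEdge = here refl ; lastEdge-col = yb
    ; tail∉V = λ { (here refl) → b∉V }
    ; closedAt = closedAt ; endEdges = endEdges
    ; tPartner = λ { (here refl) b≢b → ⊥-elim (b≢b refl) } }
    where
    y≢b : y ≢ b
    y≢b y≡b = b∉V (subst (_∈ V) y≡b y∈V)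
    closedAt : ∀ {u} → u ∈ y ∷ b ∷ [] → u ≢ b → ClosedAt (y ∷ b ∷ []) u
    closedAt (here refl) _ w d (inj₁ refl) yw =
      inj₁ (subst (_∈ y ∷ b ∷ []) (unique-colour yb yw) (there (here refl)))
    closedAt (here refl) _ w d (inj₂ refl) yw = inj₂ (y-t-edge w yw)
    closedAt (there (here refl)) b≢b = ⊥-elim (b≢b refl)
    endEdges : ∀ {u} → u ∈ y ∷ b ∷ [] → ∀ d → CT d → col B b u ≡ just d → d ≡ c
    endEdges (here refl) d _ by = just-injective (trans (sym by) (trans (col-sym B b y) yb))
    endEdges (there (here refl)) d _ bb with trans (sym (loopless B b)) bb
    ... | ()

  module Step (s : AltPath) where
    open AltPath s
    open OtherColour (other-colour ℓ-CT)

    path : List (Fin N)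
    path = y ∷ tail

    pen∈path : pen ∈ path
    pen∈path = proj₁ (∈-pairs⁻ lastEdge)

    end-pen : ℓ ≡ t → col B end pen ≡ just t
    end-pen ℓ≡t = trans (col-sym B end pen) (trans lastEdge-col (cong just ℓ≡t))

    stuck : (∀ w → col B end w ≢ just ℓ') → EscapePath B t V
    stuck none = path , y , end , (s≤s z≤n , unique , walk) , CTColored⇒AltLin _ ctColoured ,
                 refl , last≡end , y∈V , low , only-y∈V , t-edge-on-path
      where
      low : deg B end < t
      low = missing-colour⇒deg< B PC end (proj₁ (CT-range ℓ'-CT)) (proj₂ (CT-range ℓ'-CT)) none
      only-y∈V : All (λ u → u ∈ V → u ≡ y) path
      only-y∈V = All.tabulate λ { (here refl) _ → refl ; (there m) u∈V → ⊥-elim (tail∉V m u∈V) }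
      t-edge-on-path : ∀ w → col B end w ≡ just t → (end , w) ∈ pairs path ⊎ (w , end) ∈ pairs path
      t-edge-on-path w ew =
        [ (λ ℓ≡t → inj₂ (subst (λ z → (z , end) ∈ pairs path) (unique-colour (end-pen ℓ≡t) ew) lastEdge))
        , (λ ℓ'≡t → ⊥-elim (none w (trans ew (cong just (sym ℓ'≡t))))) ]′ one-is-t

    module Extend (w : Fin N) (ew : col B end w ≡ just ℓ') where
      path' : List (Fin N)
      path' = path ∷ʳ w

      w∉path : w ∉ path
      w∉path m = ℓ≢ℓ' (sym (endEdges m ℓ' ℓ'-CT ew))

      pairs-path' : pairs path' ≡ pairs path ∷ʳ (end , w)
      pairs-path' = pairs-∷ʳ path w last≡end

      cols-path' : pathCols B path' ≡ pathCols B path ∷ʳ ℓ'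
      cols-path' = trans (cong (map (edgeCol B)) pairs-path')
                     (trans (map-++ (edgeCol B) (pairs path) ((end , w) ∷ []))
                       (cong (λ k → pathCols B path ∷ʳ k) (edgeCol-col B ew)))

      unique' : Unique path'
      unique' = Unique-∷ʳ unique w∉path

      walk' : IsWalk B path'
      walk' = subst (All _) (sym pairs-path') (++⁺ walk (adj-col B ew ∷ []))

      ctColoured' : CTColored c t (pathCols B path')
      ctColoured' = subst (CTColored c t) (sym cols-path')
        (++⁺ (proj₁ ctColoured) (ℓ'-CT ∷ []) ,
         subst (All (λ e → proj₁ e ≢ proj₂ e)) (sym (pairs-∷ʳ (pathCols B path) ℓ' lastColour))
           (++⁺ (proj₂ ctColoured) (ℓ≢ℓ' ∷ [])))

      end-t-partner : ∃[ w' ] (w' ∈ path' × col B end w' ≡ just t)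
      end-t-partner =
        [ (λ ℓ≡t → pen , ∈-++⁺ˡ pen∈path , end-pen ℓ≡t)
        , (λ ℓ'≡t → w , ∈-++⁺ʳ path (here refl) , trans ew (cong just ℓ'≡t)) ]′ one-is-t

      tPartner' : ∀ {u} → u ∈ tail → ∃[ w' ] (w' ∈ path' × col B u w' ≡ just t)
      tPartner' {u} m with u ≟ end
      ... | yes refl = end-t-partner
      ... | no u≢end = let (w' , w'∈ , uw') = tPartner m u≢end in w' , ∈-++⁺ˡ w'∈ , uw'

      closes : w ∈ V → NewEar B t V E
      closes w∈V = record
        { ear = path' ; isEar = isEar ; new = end ; new∈ear = ∈-++⁺ˡ (there end∈tail)
        ; new∉V = tail∉V end∈tail ; tClosed = tClosed }
        where
        <⇒≤∸1 : ∀ {m n} → m < n → m ≤ n ∸ 1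
        <⇒≤∸1 (s≤s m≤n) = m≤n
        nonempty : ∀ (xs : List (Fin N)) → 1 ≤ length (xs ∷ʳ w)
        nonempty [] = s≤s z≤n
        nonempty (_ ∷ _) = s≤s z≤n
        last∈V : ∀ v → last path' ≡ just v → v ∈ V
        last∈V v last≡v = subst (_∈ V) (just-injective (trans (sym (last-∷ʳ path w)) last≡v)) w∈V
        inner-avoids-E : ∀ {u a b} → u ∈ inner path' → (a , b) ∈ E → u ≢ a × u ≢ b
        inner-avoids-E {u} m ab∈E =
          let u∉V = tail∉V (subst (u ∈_) (dropLast-∷ʳ tail w) m) ; (a∈V , b∈V) = within ab∈E in
          (λ { refl → u∉V a∈V }) , (λ { refl → u∉V b∈V })
        isEar : IsEar B t V E path'
        isEar = (s≤s z≤n , unique' , walk') , s≤s (nonempty tail) ,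
                (c , 1≤c , <⇒≤∸1 c<t , ctColoured') , (λ { v refl → y∈V }) , last∈V ,
                degIn-inner≡2 E path' unique' inner-avoids-E
        closed-in-V++ : ∀ {u} → u ∈ V → ∃[ w' ] (w' ∈ V ++ path' × col B u w' ≡ just t)
        closed-in-V++ u∈V = let (w' , w'∈V , uw') = closed u∈V in w' , ∈-++⁺ˡ w'∈V , uw'
        tClosed : TClosed B t (V ++ path')
        tClosed {u} m with ∈-++⁻ V m
        ... | inj₁ u∈V = closed-in-V++ u∈V
        ... | inj₂ m' with ∈-++⁻ path m'
        ...   | inj₁ (here refl) = closed-in-V++ y∈V
        ...   | inj₂ (here refl) = closed-in-V++ w∈V
        ...   | inj₁ (there mt) = let (w' , w'∈ , uw') = tPartner' mt in w' , ∈-++⁺ʳ V w'∈ , uw'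

      -- w ∉ V, so by closedAt w meets the old path only through its edge to end.
      longer : w ∉ V → AltPath
      longer w∉V = record
        { tail = tail ∷ʳ w ; end = w ; ℓ = ℓ' ; pen = end ; last≡end = last-∷ʳ path w
        ; end∈tail = ∈-++⁺ʳ tail (here refl) ; unique = unique' ; walk = walk' ; ctColoured = ctColoured'
        ; lastColour = subst (λ l → last l ≡ just ℓ') (sym cols-path') (last-∷ʳ (pathCols B path) ℓ')
        ; ℓ-CT = ℓ'-CT ; lastEdge = subst ((end , w) ∈_) (sym pairs-path') (∈-++⁺ʳ (pairs path) (here refl))
        ; lastEdge-col = ew ; tail∉V = tail∉V' ; closedAt = closedAt' ; endEdges = endEdges'
        ; tPartner = tPartner'' }
        where
        tail∉V' : ∀ {u} → u ∈ tail ∷ʳ w → u ∉ V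
        tail∉V' m with ∈-++⁻ tail m
        ... | inj₁ mt = tail∉V mt
        ... | inj₂ (here refl) = w∉V
        closedAt' : ∀ {u} → u ∈ path' → u ≢ w → ClosedAt path' u
        closedAt' {u} m u≢w w' d d-CT uw' with ∈-++⁻ path m
        ... | inj₂ (here refl) = ⊥-elim (u≢w refl)
        ... | inj₁ mp with u ≟ end
        ...   | no u≢end = map₁ ∈-++⁺ˡ (closedAt mp u≢end w' d d-CT uw')
        ...   | yes refl with CT⇒ℓ⊎ℓ' d d-CT
        ...     | inj₁ refl =
          inj₁ (∈-++⁺ˡ (subst (_∈ path) (unique-colour (trans (col-sym B end pen) lastEdge-col) uw') pen∈path))
        ...     | inj₂ refl = inj₁ (subst (_∈ path') (unique-colour ew uw') (∈-++⁺ʳ path (here refl)))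
        tPartner'' : ∀ {u} → u ∈ tail ∷ʳ w → u ≢ w → ∃[ w' ] (w' ∈ path' × col B u w' ≡ just t)
        tPartner'' m u≢w with ∈-++⁻ tail m
        ... | inj₁ mt = tPartner' mt
        ... | inj₂ (here refl) = ⊥-elim (u≢w refl)
        endEdges' : ∀ {u} → u ∈ path' → ∀ d → CT d → col B w u ≡ just d → d ≡ ℓ'
        endEdges' {u} m d d-CT wu with ∈-++⁻ path m
        ... | inj₂ (here refl) with trans (sym (loopless B w)) wu
        ...   | ()
        endEdges' {u} m d d-CT wu | inj₁ mp with u ≟ end
        ...   | yes refl = just-injective (trans (sym wu) (trans (col-sym B w end) ew))
        ...   | no u≢end with closedAt mp u≢end w d d-CT (trans (col-sym B u w) wu)
        ...     | inj₁ w∈path = ⊥-elim (w∉path w∈path)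
        ...     | inj₂ w∈V = ⊥-elim (w∉V w∈V)

    next : (NewEar B t V E ⊎ EscapePath B t V) ⊎
           ∃[ s' ] (length (outside (y ∷ AltPath.tail s')) < length (outside path))
    next with any? (λ w → ≡-dec _≟ℕ_ (col B end w) (just ℓ'))
    ... | no none = inj₁ (inj₂ (stuck λ w ew → none (w , ew)))
    ... | yes (w , ew) with w ∈? V
    ...   | yes w∈V = inj₁ (inj₁ (Extend.closes w ew w∈V))
    ...   | no w∉V = inj₂ (Extend.longer w ew w∉V ,
                           outside-shrinks ∈-++⁺ˡ (∈-++⁺ʳ path (here refl)) (Extend.w∉path w ew))

  grow : ∀ f (s : AltPath) → length (outside (y ∷ AltPath.tail s)) < f →
         NewEar B t V E ⊎ EscapePath B t V
  grow (suc f) s fuel with Step.next s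
  ... | inj₁ done = done
  ... | inj₂ (s' , shrinks) = grow f s' (≤-trans shrinks (≤-pred fuel))

  ear-or-escape : NewEar B t V E ⊎ EscapePath B t V
  ear-or-escape = grow _ start (n<1+n _)

module _ {N : ℕ} (B : Graph N) (t : ℕ) where
  open ≡-Reasoning

  EarSeq-∷ʳ : ∀ vs es ps p → EarSeq B t vs es ps →
              IsEar B t (vs ++ concat ps) (es ++ concatMap pairs ps) p → EarSeq B t vs es (ps ∷ʳ p)
  EarSeq-∷ʳ vs es [] p _ isEar =
    subst₂ (λ vs' es' → IsEar B t vs' es' p) (++-identityʳ vs) (++-identityʳ es) isEar , tt
  EarSeq-∷ʳ vs es (q ∷ ps) p (isEar-q , seq) isEar =
    isEar-q , EarSeq-∷ʳ (vs ++ q) (es ++ pairs q) ps p seq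
      (subst₂ (λ vs' es' → IsEar B t vs' es' p)
        (sym (++-assoc vs q (concat ps))) (sym (++-assoc es (pairs q) (concatMap pairs ps))) isEar)

  HVerts-∷ʳ : ∀ C ps p → HVerts B t C (ps ∷ʳ p) ≡ HVerts B t C ps ++ p
  HVerts-∷ʳ C ps p = begin
    C ++ concat (ps ∷ʳ p)        ≡⟨ cong (C ++_) (sym (concat-++ ps (p ∷ []))) ⟩
    C ++ (concat ps ++ p ++ [])  ≡⟨ cong (λ q → C ++ (concat ps ++ q)) (++-identityʳ p) ⟩
    C ++ (concat ps ++ p)        ≡⟨ sym (++-assoc C (concat ps) p) ⟩
    (C ++ concat ps) ++ p        ∎

  HEdges-∷ʳ : ∀ C ps p → HEdges B t C (ps ∷ʳ p) ≡ HEdges B t C ps ++ pairs p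
  HEdges-∷ʳ C ps p = begin
    cpairs C ++ concatMap pairs (ps ∷ʳ p)
      ≡⟨ cong (cpairs C ++_) (concatMap-++ pairs ps (p ∷ [])) ⟩
    cpairs C ++ (concatMap pairs ps ++ pairs p ++ [])
      ≡⟨ cong (λ q → cpairs C ++ (concatMap pairs ps ++ q)) (++-identityʳ (pairs p)) ⟩
    cpairs C ++ (concatMap pairs ps ++ pairs p)
      ≡⟨ sym (++-assoc (cpairs C) (concatMap pairs ps) (pairs p)) ⟩
    (cpairs C ++ concatMap pairs ps) ++ pairs p
      ∎

module EarDecomposition {N : ℕ} (B : Graph N) (t : ℕ) (PC : ProperlyColored B t) (C : List (Fin N)) where
  open import Data.List.Membership.DecPropositional (_≟_ {N}) using (_∈?_)

  H : List (List (Fin N)) → List (Fin N)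
  H = HVerts B t C

  record Invariant (ps : List (List (Fin N))) : Set where
    field
      earSeq : IsAltEarSubgraph B t C ps
      tClosed : TClosed B t (H ps)
      within : EdgesWithin (H ps) (HEdges B t C ps)

  Invariant-[] : IsCycle B C → AltCyc t (cycleCols B C) → Invariant []
  Invariant-[] cycle alt = record
    { earSeq = tt
    ; tClosed = λ m →
        let (w , w∈C , uw) = altCycle⇒t-edge B t C cycle alt (subst (_ ∈_) (++-identityʳ C) m) in
        w , ∈-++⁺ˡ w∈C , uw
    ; within = λ m → let (a∈ , b∈) = ∈-pairs⁻ (subst (_ ∈_) (++-identityʳ (cpairs C)) m) in
                     ∈-++⁺ˡ (∈-cyclic⁻ C a∈) , ∈-++⁺ˡ (∈-cyclic⁻ C b∈) }

  Invariant-∷ʳ : ∀ {ps} → Invariant ps → (new : NewEar B t (H ps) (HEdges B t C ps)) →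
                 Invariant (ps ∷ʳ NewEar.ear new)
  Invariant-∷ʳ {ps} inv new = record
    { earSeq = EarSeq-∷ʳ B t C (cpairs C) ps ear earSeq isEar
    ; tClosed = λ m → let (w , w∈ , uw) = New.tClosed (to-old m) in w , from-old w∈ , uw
    ; within = within' }
    where
    open Invariant inv
    module New = NewEar new
    open New using (ear; isEar)
    to-old : ∀ {u} → u ∈ H (ps ∷ʳ ear) → u ∈ H ps ++ ear
    to-old {u} = subst (u ∈_) (HVerts-∷ʳ B t C ps ear)
    from-old : ∀ {u} → u ∈ H ps ++ ear → u ∈ H (ps ∷ʳ ear)
    from-old {u} = subst (u ∈_) (sym (HVerts-∷ʳ B t C ps ear))
    within' : EdgesWithin (H (ps ∷ʳ ear)) (HEdges B t C (ps ∷ʳ ear))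
    within' m with ∈-++⁻ (HEdges B t C ps) (subst (_ ∈_) (HEdges-∷ʳ B t C ps ear) m)
    ... | inj₁ old = let (a∈ , b∈) = within old in from-old (∈-++⁺ˡ a∈) , from-old (∈-++⁺ˡ b∈)
    ... | inj₂ added = let (a∈ , b∈) = ∈-pairs⁻ added in from-old (∈-++⁺ʳ _ a∈) , from-old (∈-++⁺ʳ _ b∈)

  module _ (connected : ∀ u v → ∃[ p ] (IsWalk B p × head p ≡ just u × last p ≡ just v))
           {c₀ : Fin N} (c₀∈C : c₀ ∈ C) {x : Fin N} (x-low : deg B x < t) where

    Outcome : List (List (Fin N)) → Set
    Outcome ps = (∃[ v ] (v ∈ H ps × deg B v < t)) ⊎ EscapePath B t (H ps)

    step : ∀ {ps} → Invariant ps → x ∉ H ps →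
           NewEar B t (H ps) (HEdges B t C ps) ⊎ EscapePath B t (H ps)
    step {ps} inv x∉H with connected c₀ x
    ... | W , walk , hd , lst with walk-leaves B (H ps) W walk hd (∈-++⁺ˡ c₀∈C) lst x∉H
    ...   | a , b , a∈H , b∉H , ab =
      GrowingPath.ear-or-escape B PC (Invariant.tClosed inv) (Invariant.within inv)
        a∈H b∉H (Adj⇒col≡just B ab)

    extend : ∀ f ps → Invariant ps → length (outside (H ps)) < f →
             ∃[ ps' ] (IsAltEarSubgraph B t C ps' × Outcome ps')
    extend (suc f) ps inv fuel with x ∈? H ps
    ... | yes x∈H = ps , Invariant.earSeq inv , inj₁ (x , x∈H , x-low)
    ... | no x∉H with step inv x∉H
    ...   | inj₂ escape = ps , Invariant.earSeq inv , inj₂ escape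
    ...   | inj₁ new =
      extend f (ps ∷ʳ NewEar.ear new) (Invariant-∷ʳ inv new) (≤-trans shrinks (≤-pred fuel))
      where
      grown : ∀ {u} → u ∈ H ps ++ NewEar.ear new → u ∈ H (ps ∷ʳ NewEar.ear new)
      grown {u} = subst (u ∈_) (sym (HVerts-∷ʳ B t C ps (NewEar.ear new)))
      shrinks : length (outside (H (ps ∷ʳ NewEar.ear new))) < length (outside (H ps))
      shrinks =
        outside-shrinks (grown ∘ ∈-++⁺ˡ) (grown (∈-++⁺ʳ _ (NewEar.new∈ear new))) (NewEar.new∉V new)

lemma3p5 : {N : ℕ} (B : Graph N) (t : ℕ) →
    NonRegular B → TwoConnected B → MaxDeg B t → ProperlyColored B t →
    (C : List (Fin N)) → IsCycle B C → AltCyc t (cycleCols B C) →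
    All (λ v → deg B v ≡ t) C →
    ∃[ ps ] (IsAltEarSubgraph B t C ps ×
      ((∃[ x ] (x ∈ HVerts B t C ps × deg B x < t))
       ⊎
       (∃[ P ] ∃[ y ] ∃[ x ]
          (IsPath B P × AltLin t (pathCols B P) ×
           head P ≡ just y × last P ≡ just x ×
           y ∈ HVerts B t C ps × deg B x < t ×
           All (λ v → v ∈ HVerts B t C ps → v ≡ y) P ×
           (∀ w → col B x w ≡ just t → (x , w) ∈ pairs P ⊎ (w , x) ∈ pairs P)))))
lemma3p5 B t _ _ _ _ [] (() , _) _ _
lemma3p5 B t nonRegular twoConnected maxDeg PC C@(c₀ ∷ _) cycle alt _
  with nonRegular⇒low-degree B nonRegular maxDeg
... | x , x-low =
  extend (TwoConnected⇒connected B twoConnected) (here refl) x-low _ [] (Invariant-[] cycle alt) (n<1+n _)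
  where open EarDecomposition B t PC C
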